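{- Let $t,d$ be natural numbers with $0<t<d-2$ and let $x\in\mathbb Z/(d)$. Then there exists $T\subseteq\mathbb Z/(d)$ with $|T|=t$ and $\sum T=x$ (sum computed in $\mathbb Z/(d)$). -}

module Defs where

open import Data.Nat using (ℕ; _+_)
open import Data.Bool using (if_then_else_)
open import Data.Fin using (Fin; toℕ)
open import Data.Fin.Subset using (Subset)
open import Data.List using (List; map; allFin)
open import Data.Nat.ListAction using (sum)
open import Data.Vec using (lookup)

-- Z/(d) is modelled as Fin d (residues 0..d-1); a subset T of Z/(d) is a
-- Subset d (characteristic Bool-vector, library notion).
-- elemSum T = Σ_{i ∈ T} toℕ i, as a natural number. Reducing it mod d
-- gives the sum of the elements of T computed in Z/(d).
elemSum : ∀ {d} → Subset d → ℕ
elemSum {d} T = sum (map (λ i → if lookup T i then toℕ i else 0) (allFin d))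

-- The t-element subsets of {0, …, n-1} realise every sum between the minimum
-- 0 + 1 + ⋯ + (t-1) and that minimum plus t(n-t): starting from {0, …, t-1},
-- the elements can be pushed up one step at a time, each step raising the sum
-- by one. For 0 < t < d this interval contains d consecutive integers, so its
-- sums hit every residue modulo d.
module Submission where

open import Defs
open import Data.Nat using (ℕ; zero; suc; _+_; _*_; _∸_; _%_; _≤_; _<_; _≤?_; z≤n; s≤s; NonZero)
open import Data.Nat.Properties
open import Algebra.Properties.CommutativeSemigroup +-commutativeSemigroup using (x∙yz≈y∙xz; xy∙z≈zx∙y)
open import Data.Nat.DivMod using (%-distribˡ-+; m%n%n≡m%n; [m+kn]%n≡m%n; m<n⇒m%n≡m; m%n<n)
open import Data.Nat.ListAction using (sum)
open import Data.Bool using (true; false; if_then_else_)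
open import Data.Fin using (Fin; toℕ)
open import Data.Fin.Subset using (Subset; ∣_∣; ⊥)
open import Data.Fin.Subset.Properties using (∣⊥∣≡0)
open import Data.Fin.Properties using (toℕ<n)
open import Data.List using (tabulate)
open import Data.List.Properties using (map-tabulate)
open import Data.Vec using ([]; _∷_; lookup)
open import Data.Product using (Σ; ∃; _×_; _,_)
open import Function using (_∘_)
open import Relation.Nullary using (yes; no; contradiction)
open import Relation.Binary.PropositionalEquality
  using (_≡_; refl; sym; trans; cong; cong₂; module ≡-Reasoning)

subsetSum : ∀ {n} → (Fin n → ℕ) → Subset n → ℕ
subsetSum w []      = 0
subsetSum w (b ∷ T) = (if b then w Fin.zero else 0) + subsetSum (w ∘ Fin.suc) T

sum-tabulate≡subsetSum : ∀ {n} (w : Fin n → ℕ) (T : Subset n) →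
  sum (tabulate (λ i → if lookup T i then w i else 0)) ≡ subsetSum w T
sum-tabulate≡subsetSum w []      = refl
sum-tabulate≡subsetSum w (b ∷ T) = cong (_ +_) (sum-tabulate≡subsetSum (w ∘ Fin.suc) T)

elemSum≡subsetSum-toℕ : ∀ {n} (T : Subset n) → elemSum T ≡ subsetSum toℕ T
elemSum≡subsetSum-toℕ {n} T =
  trans (cong sum (map-tabulate {n = n} (λ i → i) (λ i → if lookup T i then toℕ i else 0)))
        (sum-tabulate≡subsetSum toℕ T)

subsetSum-suc : ∀ {n} (w : Fin n → ℕ) (T : Subset n) →
  subsetSum (suc ∘ w) T ≡ subsetSum w T + ∣ T ∣
subsetSum-suc w []          = refl
subsetSum-suc w (false ∷ T) = subsetSum-suc (w ∘ Fin.suc) T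
subsetSum-suc w (true ∷ T)  = begin
  suc (w Fin.zero + subsetSum (suc ∘ w ∘ Fin.suc) T)
    ≡⟨ cong (suc ∘ (w Fin.zero +_)) (subsetSum-suc (w ∘ Fin.suc) T) ⟩
  suc (w Fin.zero + (subsetSum (w ∘ Fin.suc) T + ∣ T ∣))
    ≡⟨ cong suc (sym (+-assoc (w Fin.zero) _ ∣ T ∣)) ⟩
  suc (w Fin.zero + subsetSum (w ∘ Fin.suc) T + ∣ T ∣)
    ≡⟨ sym (+-suc _ ∣ T ∣) ⟩
  w Fin.zero + subsetSum (w ∘ Fin.suc) T + suc ∣ T ∣ ∎
  where open ≡-Reasoning

-- Prepending a bit renumbers every element of T from i to i + 1.
elemSum-∷ : ∀ {n} b (T : Subset n) → elemSum (b ∷ T) ≡ elemSum T + ∣ T ∣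
elemSum-∷ b T = begin
  elemSum (b ∷ T)                    ≡⟨ elemSum≡subsetSum-toℕ (b ∷ T) ⟩
  subsetSum toℕ (b ∷ T)              ≡⟨ dropHead b ⟩
  subsetSum (suc ∘ toℕ) T            ≡⟨ subsetSum-suc toℕ T ⟩
  subsetSum toℕ T + ∣ T ∣            ≡⟨ cong (_+ ∣ T ∣) (sym (elemSum≡subsetSum-toℕ T)) ⟩
  elemSum T + ∣ T ∣                  ∎
  where
  open ≡-Reasoning
  dropHead : ∀ b → subsetSum toℕ (b ∷ T) ≡ subsetSum (suc ∘ toℕ) T
  dropHead true  = refl
  dropHead false = refl

elemSum-⊥ : ∀ n → elemSum (⊥ {n}) ≡ 0
elemSum-⊥ zero    = refl
elemSum-⊥ (suc n) = trans (elemSum-∷ false (⊥ {n})) (cong₂ _+_ (elemSum-⊥ n) (∣⊥∣≡0 n))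

triangular : ℕ → ℕ
triangular zero    = 0
triangular (suc t) = t + triangular t

-- Either 0 ∈ T and T ∖ {0} is a t-subset, or 0 ∉ T and T is a (t+1)-subset of
-- Fin (t + k) shifted up by one, which adds t + 1 to its sum.
subset-with-sum : ∀ t k r → r ≤ t * k → ∀ {n} → t + k ≡ n →
  Σ (Subset n) λ T → (∣ T ∣ ≡ t) × (elemSum T ≡ triangular t + r)
subset-with-sum zero    k .zero z≤n {n} _ = ⊥ , ∣⊥∣≡0 n , elemSum-⊥ n
subset-with-sum (suc t) k r r≤ {zero}  ()
subset-with-sum (suc t) k r r≤ {suc n} t+k≡n with r ≤? t * k
... | yes r≤t*k = insertMin (subset-with-sum t k r r≤t*k (suc-injective t+k≡n))
  where
  insertMin : Σ (Subset n) (λ T → (∣ T ∣ ≡ t) × (elemSum T ≡ triangular t + r)) →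
    Σ (Subset (suc n)) λ T → (∣ T ∣ ≡ suc t) × (elemSum T ≡ triangular (suc t) + r)
  insertMin (T , ∣T∣≡t , sumT) = true ∷ T , cong suc ∣T∣≡t , (begin
    elemSum (true ∷ T)        ≡⟨ elemSum-∷ true T ⟩
    elemSum T + ∣ T ∣         ≡⟨ cong₂ _+_ sumT ∣T∣≡t ⟩
    triangular t + r + t      ≡⟨ xy∙z≈zx∙y (triangular t) r t ⟩
    triangular (suc t) + r    ∎)
    where open ≡-Reasoning
subset-with-sum (suc t) (suc k) r r≤ {suc n} t+k≡n | no r≰t*k =
  shiftUp (subset-with-sum (suc t) k (r ∸ suc t) r∸t≤ (trans (sym (+-suc t k)) (suc-injective t+k≡n)))
  where
  r∸t≤ : r ∸ suc t ≤ suc t * k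
  r∸t≤ = m≤n+o⇒m∸n≤o r (suc t) (≤-trans r≤ (≤-reflexive (*-suc (suc t) k)))
  t<r : suc t ≤ r
  t<r = ≤-trans (s≤s (m≤m*n t (suc k))) (≰⇒> r≰t*k)
  shiftUp : Σ (Subset n) (λ T → (∣ T ∣ ≡ suc t) × (elemSum T ≡ triangular (suc t) + (r ∸ suc t))) →
    Σ (Subset (suc n)) λ T → (∣ T ∣ ≡ suc t) × (elemSum T ≡ triangular (suc t) + r)
  shiftUp (T , ∣T∣≡t , sumT) = false ∷ T , ∣T∣≡t , (begin
    elemSum (false ∷ T)                          ≡⟨ elemSum-∷ false T ⟩
    elemSum T + ∣ T ∣                            ≡⟨ cong₂ _+_ sumT ∣T∣≡t ⟩
    triangular (suc t) + (r ∸ suc t) + suc t     ≡⟨ +-assoc (triangular (suc t)) (r ∸ suc t) (suc t) ⟩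
    triangular (suc t) + (r ∸ suc t + suc t)     ≡⟨ cong (triangular (suc t) +_) (m∸n+n≡m t<r) ⟩
    triangular (suc t) + r                       ∎)
    where open ≡-Reasoning
subset-with-sum (suc t) zero r r≤ {suc n} t+k≡n | no r≰t*0 =
  contradiction (≤-trans r≤ (≤-reflexive (trans (*-zeroʳ (suc t)) (sym (*-zeroʳ t))))) r≰t*0

r<m+n⇒r≤m*n : ∀ {r m n} → 0 < m → 0 < n → r < m + n → r ≤ m * n
r<m+n⇒r≤m*n {r} {suc m} {suc n} _ _ (s≤s r≤m+n) = begin
  r                 ≤⟨ r≤m+n ⟩
  m + suc n         ≡⟨ +-comm m (suc n) ⟩
  suc n + m         ≤⟨ +-monoʳ-≤ (suc n) (m≤m*n m (suc n)) ⟩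
  suc n + m * suc n ∎
  where open ≤-Reasoning

r<n⇒r≤m*[n∸m] : ∀ {r m n} → 0 < m → m < n → r < n → r ≤ m * (n ∸ m)
r<n⇒r≤m*[n∸m] 0<m m<n r<n =
  r<m+n⇒r≤m*n 0<m (m<n⇒0<n∸m m<n) (<-≤-trans r<n (≤-reflexive (sym (m+[n∸m]≡n (<⇒≤ m<n)))))

[m+n%o]%o≡[m+n]%o : ∀ m n o .{{_ : NonZero o}} → (m + n % o) % o ≡ (m + n) % o
[m+n%o]%o≡[m+n]%o m n o = begin
  (m + n % o) % o             ≡⟨ %-distribˡ-+ m (n % o) o ⟩
  (m % o + n % o % o) % o     ≡⟨ cong (λ k → (m % o + k) % o) (m%n%n≡m%n n o) ⟩
  (m % o + n % o) % o         ≡⟨ sym (%-distribˡ-+ m n o) ⟩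
  (m + n) % o                 ∎
  where open ≡-Reasoning

-- The witness (x + (m * d ∸ m)) % d is chosen so that adding m gives x + m * d.
+-%-surjective : ∀ m {d} .{{_ : NonZero d}} x → x < d → ∃ λ r → (r < d) × ((m + r) % d ≡ x)
+-%-surjective m {d} x x<d = (x + (m * d ∸ m)) % d , m%n<n _ d , (begin
  (m + (x + (m * d ∸ m)) % d) % d   ≡⟨ [m+n%o]%o≡[m+n]%o m _ d ⟩
  (m + (x + (m * d ∸ m))) % d       ≡⟨ cong (_% d) (m+[x+[m*d∸m]]≡x+m*d) ⟩
  (x + m * d) % d                   ≡⟨ [m+kn]%n≡m%n x m d ⟩
  x % d                             ≡⟨ m<n⇒m%n≡m x<d ⟩
  x                                 ∎)
  where
  open ≡-Reasoning
  m+[x+[m*d∸m]]≡x+m*d : m + (x + (m * d ∸ m)) ≡ x + m * d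
  m+[x+[m*d∸m]]≡x+m*d = begin
    m + (x + (m * d ∸ m))   ≡⟨ x∙yz≈y∙xz m x _ ⟩
    x + (m + (m * d ∸ m))   ≡⟨ cong (x +_) (m+[n∸m]≡n (m≤m*n m d)) ⟩
    x + m * d               ∎

subset-with-residue : ∀ t d .{{_ : NonZero d}} → 0 < t → t < d → (x : Fin d) →
  Σ (Subset d) λ T → (∣ T ∣ ≡ t) × (elemSum T % d ≡ toℕ x)
subset-with-residue t d 0<t t<d x
  with r , r<d , r-hits-x ← +-%-surjective (triangular t) (toℕ x) (toℕ<n x)
  with T , ∣T∣≡t , sumT ← subset-with-sum t (d ∸ t) r (r<n⇒r≤m*[n∸m] 0<t t<d r<d) (m+[n∸m]≡n (<⇒≤ t<d))
  = T , ∣T∣≡t , trans (cong (_% d) sumT) r-hits-x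

mainTheorem3 : (t d : ℕ) → .{{_ : NonZero d}} → 0 < t → t < d ∸ 2 → (x : Fin d) →
    Σ (Subset d) (λ T → (∣ T ∣ ≡ t) × (elemSum T % d ≡ toℕ x))
mainTheorem3 t d 0<t t<d-2 = subset-with-residue t d 0<t (<-≤-trans t<d-2 (m∸n≤m d 2))
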